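{- Let $0<k<n$ and let $(u),(w)\in C_{k,n}$. The simplices $\Delta_{(u)}$ and $\Delta_{(w)}$ share a common facet if and only if there is a representative $u=u_1\cdots u_n$ of the cycle $(u)$ and an index $i\in[n]$ (with $u_{n+1}:=u_1$) such that $u_i-u_{i+1}\not\equiv\pm1\pmod n$ and $(w)=(u_i,u_{i+1})\,(u)\,(u_i,u_{i+1})$, i.e. $(w)$ is obtained from $(u)$ by switching the entries $u_i$ and $u_{i+1}$.
   Context: $\epsilon_I\in\mathbb{R}^n$ is the 0/1 indicator vector of $I\subseteq[n]$. The directed graph $G_{k,n}$ has vertices $\epsilon_I$ for $|I|=k$; indices are read mod $n$; there is an edge $\epsilon\xrightarrow{i}\epsilon'$ labelled $i\in[n]$ when $(\epsilon_i,\epsilon_{i+1})=(1,0)$ and $\epsilon'$ is $\epsilon$ with $\epsilon_i,\epsilon_{i+1}$ swapped. A minimal circuit is a directed circuit of minimal length in $G_{k,n}$ (each ``1'' moves step by step to the position of the next ``1'' cyclically); it has length $n$ and its successive edge labels $w_1,\dots,w_n$ form a permutation of $[n]$, determined up to cyclic shift. For a permutation $w=w_1\cdots w_n$, $(w)=(w_1,\dots,w_n)$ denotes the corresponding long cycle in $S_n$ (cycle notation). $C_{k,n}$ is the set of long cycles $(w)=(w_1,\dots,w_{n-1},n)$ such that $w^{ -1}$ has exactly $k-1$ descents (indices $j$ with $w^{ -1}(j)>w^{ -1}(j+1)$); these are exactly the cyclic label sequences of minimal circuits, and for $(w)\in C_{k,n}$, $c_{(w)}$ is the minimal circuit with edge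 labels $w_1,\dots,w_n$ in order and $\Delta_{(w)}$ is the convex hull of its vertices. The simplices $\Delta_{(w)}$, $(w)\in C_{k,n}$, triangulate the hypersimplex $\mathrm{conv}\{\epsilon_I:|I|=k\}$. -}

module Defs where

open import Data.Nat using (ℕ; zero; suc; _∸_; _<_)
open import Data.Nat.DivMod using (_mod_)
open import Data.Fin using (Fin; toℕ; fromℕ; inject₁) renaming (suc to fsuc; _<?_ to _<ᶠ?_)
open import Data.Fin.Permutation using (Permutation′; _⟨$⟩ʳ_; _⟨$⟩ˡ_; transpose)
open import Data.Bool using (Bool; true; false)
open import Data.Vec using (Vec; lookup; tabulate; countᵇ)
open import Data.List using (List; []; _∷_; length; filter; allFin; map)
open import Data.List.Membership.Propositional using (_∈_)
open import Data.List.Relation.Unary.All using (All)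
open import Data.List.Relation.Unary.Unique.Propositional using (Unique)
open import Data.Product using (Σ; ∃; ∃-syntax; _×_)
open import Data.Empty using (⊥)
open import Relation.Nullary using (¬_)
open import Relation.Binary.PropositionalEquality using (_≡_)

-- Labels / positions / values in [n] are represented by Fin n, shifted by one
-- (the paper's label i ∈ {1,…,n} is the Fin n element i-1).

sucMod : ∀ {n} → Fin n → Fin n
sucMod {suc m} i = suc (toℕ i) mod suc m

addMod : ∀ {n} → Fin n → Fin n → Fin n
addMod {suc m} i r = (toℕ i + toℕ r) mod suc m
  where open Data.Nat using (_+_)

ones : ∀ {n} → Vec Bool n → ℕ
ones ε = countᵇ (λ b → b) ε

swapAt : ∀ {n} → Fin n → Vec Bool n → Vec Bool n
swapAt i ε = tabulate (λ x → lookup ε (transpose i (sucMod i) ⟨$⟩ʳ x))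

Edge : ∀ {n} → Vec Bool n → Fin n → Vec Bool n → Set
Edge ε i ε' = (lookup ε i ≡ true) × (lookup ε (sucMod i) ≡ false) × (ε' ≡ swapAt i ε)

data Walk {n : ℕ} : Vec Bool n → List (Fin n) → Vec Bool n → Set where
  []  : ∀ {ε} → Walk ε [] ε
  _∷_ : ∀ {ε i ε' is ε''} → Edge ε i ε' → Walk ε' is ε'' → Walk ε (i ∷ is) ε''

visited : ∀ {n ε is ε''} → Walk {n} ε is ε'' → List (Vec Bool n)
visited {ε = ε} []       = []
visited {ε = ε} (_ ∷ p)  = ε ∷ visited p

-- a word w = w_1 ⋯ w_n is a permutation in one-line notation: w_j = w ⟨$⟩ʳ j
labels : ∀ {n} → Permutation′ n → List (Fin n)
labels {n} w = map (w ⟨$⟩ʳ_) (allFin n)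

-- the long cycle (w) = (w_1, …, w_n) as a permutation: w_j ↦ w_{j+1}
cyc : ∀ {n} → Permutation′ n → Fin n → Fin n
cyc w x = w ⟨$⟩ʳ sucMod (w ⟨$⟩ˡ x)

descents : ∀ {n} → (Fin n → Fin n) → ℕ
descents {zero}  f = 0
descents {suc m} f = length (filter (λ j → f (fsuc j) <ᶠ? f (inject₁ j)) (allFin m))

-- (w) ∈ C_{k,n}: w = (w_1,…,w_{n-1},n) and w⁻¹ has exactly k-1 descents
InC : (k n : ℕ) → Permutation′ n → Set
InC k zero    w = ⊥
InC k (suc m) w = (w ⟨$⟩ʳ fromℕ m ≡ fromℕ m) × (descents (w ⟨$⟩ˡ_) ≡ k ∸ 1)

-- ε is a vertex of c_(w): it lies on a closed walk in G_{k,n} whose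
-- successive edge labels are w_1, …, w_n
IsVertex : (k : ℕ) {n : ℕ} → Permutation′ n → Vec Bool n → Set
IsVertex k {n} w ε =
  ∃[ ε₀ ] (ones ε₀ ≡ k) × Σ (Walk ε₀ (labels w) ε₀) (λ p → ε ∈ visited p)

-- Δ_(u) and Δ_(w) share a common facet: they are distinct simplices and
-- there are n-1 distinct points that are vertices of both
-- (a facet of an (n-1)-simplex is the convex hull of n-1 of its vertices)
SharesFacet : (k : ℕ) {n : ℕ} → Permutation′ n → Permutation′ n → Set
SharesFacet k {n} u w =
  (∃[ ε ] IsVertex k u ε × ¬ IsVertex k w ε)
  × (∃[ F ] (length F ≡ n ∸ 1) × Unique F × All (λ ε → IsVertex k u ε × IsVertex k w ε) F)

-- (w) is obtained from (u) by switching two cyclically adjacent entries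
-- u_i, u_{i+1} of some representative u (a rotation of the word) with
-- u_i - u_{i+1} ≢ ±1 (mod n): (w) = (u_i,u_{i+1}) (u) (u_i,u_{i+1})
SwitchRelated : {n : ℕ} → Permutation′ n → Permutation′ n → Set
SwitchRelated {n} u w =
  ∃[ r ] ∃[ i ]
    let v : Fin n → Fin n
        v j = u ⟨$⟩ʳ addMod j r
        a = v i
        b = v (sucMod i)
    in ¬ (sucMod b ≡ a) × ¬ (sucMod a ≡ b)
       × (∀ x → cyc w x ≡ transpose a b ⟨$⟩ʳ (cyc u (transpose a b ⟨$⟩ʳ x)))

module Submission where

-- Explicit vertices: the vertex of c_(u) just before the edge u_j has a one at
-- p iff, reading u cyclically from position j, the label p precedes p - 1; at
-- j = 1 this gives 1 + des(u⁻¹) = k ones.  The sum of the positions of the ones,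
-- mod n, goes up by one along every edge, so c_(u) has n distinct vertices, and
-- two consecutive vertices of c_(u) lying on c_(w) are joined by the same edge
-- of c_(w).
--
-- By counting, Δ_(u) and Δ_(w) share a facet iff exactly one vertex of c_(u),
-- the one between the edges a = u_J and b = u_(J+1), is not on c_(w).  Then
-- c_(w) contains every other edge of c_(u), and the only way to complete it is
-- by b followed by a, so (w) = (a b)(u)(a b).  Conversely, switching
-- non-adjacent a and b only changes the relative order of a and b, which only
-- the vertex between them sees.

open import Data.Bool using (Bool; true; false; if_then_else_)
import Data.Bool.Properties as Bool
open import Data.Empty using (⊥-elim)
open import Data.Fin using (Fin; toℕ; fromℕ; inject₁; lower₁; punchIn; punchOut)
  renaming (zero to fzero; suc to fsuc)
import Data.Fin.Properties as Fin
open import Data.Fin.Permutation using (Permutation′; _⟨$⟩ʳ_; _⟨$⟩ˡ_; inverseˡ; inverseʳ; transpose)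
import Data.Fin.Permutation.Components as PC
import Data.List as List
open import Data.List using (List; []; _∷_; map; allFin; length; filter)
open import Data.List.Membership.Propositional using (_∈_)
open import Data.List.Membership.Propositional.Properties using (∈-map⁺; ∈-map⁻; ∈-allFin; ∈-lookup)
open import Data.List.Properties using (length-map; length-tabulate)
open import Data.List.Relation.Unary.All as All using (All)
open import Data.List.Relation.Unary.AllPairs using (_∷_)
open import Data.List.Relation.Unary.Any using (any?)
open import Data.List.Relation.Unary.Unique.Propositional using (Unique)
import Data.List.Relation.Unary.Unique.Propositional.Properties as Unique
open import Data.Nat using (ℕ; zero; suc; _+_; _∸_; _<_; _<?_; z≤n; s≤s; _%_; NonZero; >-nonZero⁻¹)
open import Data.Nat.DivMod
open import Data.Nat.GeneralisedArithmetic using (iterate)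
open import Data.Nat.Properties
open import Algebra.Properties.CommutativeMonoid.Sum +-0-commutativeMonoid
  using (sum; sum-cong-≗; ∑-distrib-+; sum-remove; sum-replicate-zero)
open import Data.Product using (∃-syntax; _×_; _,_; proj₁; proj₂)
open import Data.Sum using (inj₁; inj₂)
open import Data.Vec using (Vec; lookup; tabulate; countᵇ)
open import Data.Vec.Properties using (lookup∘tabulate; tabulate-cong; tabulate∘lookup; ≡-dec)
open import Function using (_∘_; id)
open import Function.Bundles using (_⇔_; mk⇔)
open import Function.Definitions using (Injective)
open import Function.Properties.Equivalence using () renaming (trans to ⇔-trans; sym to ⇔-sym)
open import Relation.Binary using (DecidableEquality)
open import Relation.Binary.PropositionalEquality
open import Relation.Nullary using (¬_; Dec; yes; no; does; contradiction)
open import Relation.Nullary.Decidable using (dec-true; dec-false)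
open import Relation.Unary using (Decidable)

open import Defs
open ≡-Reasoning

-- Cyclic arithmetic on Fin (suc m)

[m%n+k]%n≡[m+k]%n : ∀ a b n .{{_ : NonZero n}} → (a % n + b) % n ≡ (a + b) % n
[m%n+k]%n≡[m+k]%n a b n = begin
  (a % n + b) % n          ≡⟨ %-distribˡ-+ (a % n) b n ⟩
  (a % n % n + b % n) % n  ≡⟨ cong (λ x → (x + b % n) % n) (m%n%n≡m%n a n) ⟩
  (a % n + b % n) % n      ≡⟨ %-distribˡ-+ a b n ⟨
  (a + b) % n              ∎

[m+k%n]%n≡[m+k]%n : ∀ a b n .{{_ : NonZero n}} → (a + b % n) % n ≡ (a + b) % n
[m+k%n]%n≡[m+k]%n a b n = begin
  (a + b % n) % n  ≡⟨ cong (_% n) (+-comm a (b % n)) ⟩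
  (b % n + a) % n  ≡⟨ [m%n+k]%n≡[m+k]%n b a n ⟩
  (b + a) % n      ≡⟨ cong (_% n) (+-comm b a) ⟩
  (a + b) % n      ∎

module _ {m : ℕ} where

  private
    n : ℕ
    n = suc m

  predMod : Fin n → Fin n
  predMod fzero    = fromℕ m
  predMod (fsuc i) = inject₁ i

  toℕ-sucMod : (i : Fin n) → toℕ (sucMod i) ≡ suc (toℕ i) % n
  toℕ-sucMod i = Fin.toℕ-fromℕ< _

  sucMod-predMod : (i : Fin n) → sucMod (predMod i) ≡ i
  sucMod-predMod fzero = Fin.toℕ-injective (begin
    toℕ (sucMod (fromℕ m))   ≡⟨ toℕ-sucMod (fromℕ m) ⟩
    suc (toℕ (fromℕ m)) % n  ≡⟨ cong (λ x → suc x % n) (Fin.toℕ-fromℕ m) ⟩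
    n % n                    ≡⟨ n%n≡0 n ⟩
    0                        ∎)
  sucMod-predMod (fsuc i) = Fin.toℕ-injective (begin
    toℕ (sucMod (inject₁ i))   ≡⟨ toℕ-sucMod (inject₁ i) ⟩
    suc (toℕ (inject₁ i)) % n  ≡⟨ cong (λ x → suc x % n) (Fin.toℕ-inject₁ i) ⟩
    suc (toℕ i) % n            ≡⟨ m<n⇒m%n≡m (s≤s (Fin.toℕ<n i)) ⟩
    suc (toℕ i)                ∎)

  predMod-surjective : (i : Fin n) → ∃[ j ] predMod j ≡ i
  predMod-surjective i with m ≟ toℕ i
  ... | yes m≡i = fzero , Fin.toℕ-injective (trans (Fin.toℕ-fromℕ m) m≡i)
  ... | no m≢i  = fsuc (lower₁ i m≢i) , Fin.inject₁-lower₁ i m≢i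

  predMod-sucMod : (i : Fin n) → predMod (sucMod i) ≡ i
  predMod-sucMod i with j , refl ← predMod-surjective i = cong predMod (sucMod-predMod j)

  sucMod-injective : ∀ {i j : Fin n} → sucMod i ≡ sucMod j → i ≡ j
  sucMod-injective {i} {j} eq = begin
    i                   ≡⟨ predMod-sucMod i ⟨
    predMod (sucMod i)  ≡⟨ cong predMod eq ⟩
    predMod (sucMod j)  ≡⟨ predMod-sucMod j ⟩
    j                   ∎

  infixl 6 _⊕_
  _⊕_ : Fin n → ℕ → Fin n
  i ⊕ e = iterate sucMod i e

  ⊕-suc : ∀ (i : Fin n) e → i ⊕ suc e ≡ sucMod (i ⊕ e)
  ⊕-suc i zero    = refl
  ⊕-suc i (suc e) = ⊕-suc (sucMod i) e

  ⊕-+ : ∀ (i : Fin n) e f → i ⊕ (e + f) ≡ i ⊕ e ⊕ f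
  ⊕-+ i zero    f = refl
  ⊕-+ i (suc e) f = ⊕-+ (sucMod i) e f

  ⊕-comm : ∀ (i : Fin n) e f → i ⊕ e ⊕ f ≡ i ⊕ f ⊕ e
  ⊕-comm i e f = begin
    i ⊕ e ⊕ f    ≡⟨ ⊕-+ i e f ⟨
    i ⊕ (e + f)  ≡⟨ cong (i ⊕_) (+-comm e f) ⟩
    i ⊕ (f + e)  ≡⟨ ⊕-+ i f e ⟩
    i ⊕ f ⊕ e    ∎

  ⊕-cancelʳ : ∀ {i j : Fin n} e → i ⊕ e ≡ j ⊕ e → i ≡ j
  ⊕-cancelʳ zero    eq = eq
  ⊕-cancelʳ (suc e) eq = sucMod-injective (⊕-cancelʳ e eq)

  toℕ-⊕ : ∀ (i : Fin n) e → toℕ (i ⊕ e) ≡ (toℕ i + e) % n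
  toℕ-⊕ i zero = begin
    toℕ i            ≡⟨ m<n⇒m%n≡m (Fin.toℕ<n i) ⟨
    toℕ i % n        ≡⟨ cong (_% n) (+-identityʳ (toℕ i)) ⟨
    (toℕ i + 0) % n  ∎
  toℕ-⊕ i (suc e) = begin
    toℕ (sucMod i ⊕ e)         ≡⟨ toℕ-⊕ (sucMod i) e ⟩
    (toℕ (sucMod i) + e) % n   ≡⟨ cong (λ x → (x + e) % n) (toℕ-sucMod i) ⟩
    (suc (toℕ i) % n + e) % n  ≡⟨ [m%n+k]%n≡[m+k]%n (suc (toℕ i)) e n ⟩
    (suc (toℕ i) + e) % n      ≡⟨ cong (_% n) (+-suc (toℕ i) e) ⟨
    (toℕ i + suc e) % n        ∎

  ⊕-period : ∀ (i : Fin n) → i ⊕ n ≡ i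
  ⊕-period i = Fin.toℕ-injective (begin
    toℕ (i ⊕ n)      ≡⟨ toℕ-⊕ i n ⟩
    (toℕ i + n) % n  ≡⟨ [m+n]%n≡m%n (toℕ i) n ⟩
    toℕ i % n        ≡⟨ m<n⇒m%n≡m (Fin.toℕ<n i) ⟩
    toℕ i            ∎)

  ⊕-toℕ-sucMod : ∀ (i a : Fin n) → i ⊕ toℕ (sucMod a) ≡ i ⊕ suc (toℕ a)
  ⊕-toℕ-sucMod i a = Fin.toℕ-injective (begin
    toℕ (i ⊕ toℕ (sucMod a))       ≡⟨ toℕ-⊕ i (toℕ (sucMod a)) ⟩
    (toℕ i + toℕ (sucMod a)) % n   ≡⟨ cong (λ x → (toℕ i + x) % n) (toℕ-sucMod a) ⟩
    (toℕ i + suc (toℕ a) % n) % n  ≡⟨ [m+k%n]%n≡[m+k]%n (toℕ i) (suc (toℕ a)) n ⟩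
    (toℕ i + suc (toℕ a)) % n      ≡⟨ toℕ-⊕ i (suc (toℕ a)) ⟨
    toℕ (i ⊕ suc (toℕ a))          ∎)

  fzero⊕toℕ : ∀ (i : Fin n) → fzero ⊕ toℕ i ≡ i
  fzero⊕toℕ i = Fin.toℕ-injective (trans (toℕ-⊕ fzero (toℕ i)) (m<n⇒m%n≡m (Fin.toℕ<n i)))

  dist : Fin n → Fin n → ℕ
  dist i j = (n ∸ toℕ i + toℕ j) % n

  dist< : ∀ (i j : Fin n) → dist i j < n
  dist< i j = m%n<n (n ∸ toℕ i + toℕ j) n

  ⊕-dist : ∀ (i j : Fin n) → i ⊕ dist i j ≡ j
  ⊕-dist i j = Fin.toℕ-injective (begin
    toℕ (i ⊕ dist i j)                 ≡⟨ toℕ-⊕ i (dist i j) ⟩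
    (toℕ i + dist i j) % n             ≡⟨ [m+k%n]%n≡[m+k]%n (toℕ i) _ n ⟩
    (toℕ i + (n ∸ toℕ i + toℕ j)) % n  ≡⟨ cong (_% n) (+-assoc (toℕ i) _ (toℕ j)) ⟨
    (toℕ i + (n ∸ toℕ i) + toℕ j) % n  ≡⟨ cong (λ x → (x + toℕ j) % n) (m+[n∸m]≡n (<⇒≤ (Fin.toℕ<n i))) ⟩
    (n + toℕ j) % n                    ≡⟨ cong (_% n) (+-comm n (toℕ j)) ⟩
    (toℕ j + n) % n                    ≡⟨ [m+n]%n≡m%n (toℕ j) n ⟩
    toℕ j % n                          ≡⟨ m<n⇒m%n≡m (Fin.toℕ<n j) ⟩
    toℕ j                              ∎)

  dist-⊕ : ∀ (i : Fin n) {e} → e < n → dist i (i ⊕ e) ≡ e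
  dist-⊕ i {e} e<n = begin
    (n ∸ toℕ i + toℕ (i ⊕ e)) % n      ≡⟨ cong (λ x → (n ∸ toℕ i + x) % n) (toℕ-⊕ i e) ⟩
    (n ∸ toℕ i + (toℕ i + e) % n) % n  ≡⟨ [m+k%n]%n≡[m+k]%n (n ∸ toℕ i) (toℕ i + e) n ⟩
    (n ∸ toℕ i + (toℕ i + e)) % n      ≡⟨ cong (_% n) (+-assoc (n ∸ toℕ i) (toℕ i) e) ⟨
    (n ∸ toℕ i + toℕ i + e) % n        ≡⟨ cong (λ x → (x + e) % n) (m∸n+n≡m (<⇒≤ (Fin.toℕ<n i))) ⟩
    (n + e) % n                        ≡⟨ cong (_% n) (+-comm n e) ⟩
    (e + n) % n                        ≡⟨ [m+n]%n≡m%n e n ⟩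
    e % n                              ≡⟨ m<n⇒m%n≡m e<n ⟩
    e                                  ∎

  dist-refl : ∀ (i : Fin n) → dist i i ≡ 0
  dist-refl i = dist-⊕ i (s≤s z≤n)

  dist-injective : ∀ (i : Fin n) {j k} → dist i j ≡ dist i k → j ≡ k
  dist-injective i {j} {k} eq = begin
    j             ≡⟨ ⊕-dist i j ⟨
    i ⊕ dist i j  ≡⟨ cong (i ⊕_) eq ⟩
    i ⊕ dist i k  ≡⟨ ⊕-dist i k ⟩
    k             ∎

  dist≡0⇒≡ : ∀ {i j : Fin n} → dist i j ≡ 0 → i ≡ j
  dist≡0⇒≡ {i} eq = dist-injective i (trans (dist-refl i) (sym eq))

  dist-fzero : ∀ (i : Fin n) → dist fzero i ≡ toℕ i
  dist-fzero i = trans (cong (dist fzero) (sym (fzero⊕toℕ i))) (dist-⊕ fzero (Fin.toℕ<n i))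

  dist-⊕-suc : ∀ (i : Fin n) {e} → e < n → i ⊕ suc e ≢ i → dist i (i ⊕ suc e) ≡ suc e
  dist-⊕-suc i {e} e<n ≢i with m≤n⇒m<n∨m≡n (≤-pred e<n)
  ... | inj₁ e<m  = dist-⊕ i (s≤s e<m)
  ... | inj₂ refl = ⊥-elim (≢i (⊕-period i))

  dist-sucModʳ : ∀ (i j : Fin n) → sucMod j ≢ i → dist i (sucMod j) ≡ suc (dist i j)
  dist-sucModʳ i j Sj≢i = begin
    dist i (sucMod j)            ≡⟨ cong (dist i) Sj≡ ⟩
    dist i (i ⊕ suc (dist i j))  ≡⟨ dist-⊕-suc i (dist< i j) (Sj≢i ∘ trans Sj≡) ⟩
    suc (dist i j)               ∎
    where
    Sj≡ : sucMod j ≡ i ⊕ suc (dist i j)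
    Sj≡ = trans (cong sucMod (sym (⊕-dist i j))) (sym (⊕-suc i (dist i j)))

  dist-sucModˡ : ∀ (i j : Fin n) → j ≢ i → dist i j ≡ suc (dist (sucMod i) j)
  dist-sucModˡ i j j≢i = begin
    dist i j                              ≡⟨ cong (dist i) (⊕-dist (sucMod i) j) ⟨
    dist i (i ⊕ suc (dist (sucMod i) j))  ≡⟨ dist-⊕-suc i (dist< (sucMod i) j) (j≢i ∘ trans (sym (⊕-dist (sucMod i) j))) ⟩
    suc (dist (sucMod i) j)               ∎

  dist-sucMod-self : ∀ (i : Fin n) → dist (sucMod i) i ≡ m
  dist-sucMod-self i = begin
    dist (sucMod i) i               ≡⟨ cong (dist (sucMod i)) (⊕-period i) ⟨
    dist (sucMod i) (sucMod i ⊕ m)  ≡⟨ dist-⊕ (sucMod i) ≤-refl ⟩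
    m                               ∎

  dist-⊕-invariant : ∀ (i j : Fin n) h → dist (i ⊕ h) (j ⊕ h) ≡ dist i j
  dist-⊕-invariant i j h = begin
    dist (i ⊕ h) (j ⊕ h)             ≡⟨ cong (λ x → dist (i ⊕ h) (x ⊕ h)) (⊕-dist i j) ⟨
    dist (i ⊕ h) (i ⊕ dist i j ⊕ h)  ≡⟨ cong (dist (i ⊕ h)) (⊕-comm i (dist i j) h) ⟩
    dist (i ⊕ h) (i ⊕ h ⊕ dist i j)  ≡⟨ dist-⊕ (i ⊕ h) (dist< i j) ⟩
    dist i j                         ∎

  ⊕-surjective : ∀ h (j : Fin n) → ∃[ i ] i ⊕ h ≡ j
  ⊕-surjective h j = j ⊕ dist (j ⊕ h) j , (begin
    j ⊕ dist (j ⊕ h) j ⊕ h  ≡⟨ ⊕-comm j (dist (j ⊕ h) j) h ⟩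
    j ⊕ h ⊕ dist (j ⊕ h) j  ≡⟨ ⊕-dist (j ⊕ h) j ⟩
    j                       ∎)

  ⊕-homomorphic : ∀ {f : Fin n → Fin n} → (∀ i → f (sucMod i) ≡ sucMod (f i)) → ∀ i e → f (i ⊕ e) ≡ f i ⊕ e
  ⊕-homomorphic f-hom i zero    = refl
  ⊕-homomorphic f-hom i (suc e) = trans (⊕-homomorphic f-hom (sucMod i) e) (cong (_⊕ e) (f-hom i))

  sucMod-homomorphic⇒injective : ∀ {f : Fin n → Fin n} → (∀ i → f (sucMod i) ≡ sucMod (f i)) →
                                 ∀ {i j} → f i ≡ f j → i ≡ j
  sucMod-homomorphic⇒injective {f} f-hom {i} {j} fi≡fj = dist≡0⇒≡ (begin
    dist i j                       ≡⟨ dist-⊕ (f i) (dist< i j) ⟨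
    dist (f i) (f i ⊕ dist i j)    ≡⟨ cong (dist (f i)) (⊕-homomorphic f-hom i (dist i j)) ⟨
    dist (f i) (f (i ⊕ dist i j))  ≡⟨ cong (λ x → dist (f i) (f x)) (⊕-dist i j) ⟩
    dist (f i) (f j)               ≡⟨ cong (dist (f i)) fi≡fj ⟨
    dist (f i) (f i)               ≡⟨ dist-refl (f i) ⟩
    0                              ∎)

  sucMod≢ : .{{NonZero m}} → ∀ (i : Fin n) → sucMod i ≢ i
  sucMod≢ i eq = contradiction (begin
    1                  ≡⟨ dist-⊕ i (s≤s (>-nonZero⁻¹ m)) ⟨
    dist i (sucMod i)  ≡⟨ cong (dist i) eq ⟩
    dist i i           ≡⟨ dist-refl i ⟩
    0                  ∎) λ ()

  predMod≢ : .{{NonZero m}} → ∀ (i : Fin n) → predMod i ≢ i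
  predMod≢ i eq = sucMod≢ (predMod i) (trans (sucMod-predMod i) (sym eq))

-- Transpositions and permutations

module _ {n : ℕ} where

  transpose-matchˡ : ∀ (i j : Fin n) → PC.transpose i j i ≡ j
  transpose-matchˡ i j rewrite dec-true (i Fin.≟ i) refl = refl

  transpose-matchʳ : ∀ (i j : Fin n) → PC.transpose i j j ≡ i
  transpose-matchʳ i j with j Fin.≟ i
  ... | yes j≡i = j≡i
  ... | no _ rewrite dec-true (j Fin.≟ j) refl = refl

  transpose-other : ∀ {i j k : Fin n} → k ≢ i → k ≢ j → PC.transpose i j k ≡ k
  transpose-other {i} {j} {k} k≢i k≢j rewrite dec-false (k Fin.≟ i) k≢i | dec-false (k Fin.≟ j) k≢j = refl

  transpose-involutive : ∀ (i j k : Fin n) → PC.transpose i j (PC.transpose i j k) ≡ k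
  transpose-involutive i j k = by-cases (k Fin.≟ i) (k Fin.≟ j)
    where
    by-cases : Dec (k ≡ i) → Dec (k ≡ j) → PC.transpose i j (PC.transpose i j k) ≡ k
    by-cases (yes refl) _       = trans (cong (PC.transpose k j) (transpose-matchˡ k j)) (transpose-matchʳ k j)
    by-cases (no _) (yes refl)  = trans (cong (PC.transpose i k) (transpose-matchʳ i k)) (transpose-matchˡ i k)
    by-cases (no k≢i) (no k≢j) = trans (cong (PC.transpose i j) (transpose-other k≢i k≢j)) (transpose-other k≢i k≢j)

  transpose-injective : ∀ (i j : Fin n) {k l} → PC.transpose i j k ≡ PC.transpose i j l → k ≡ l
  transpose-injective i j {k} {l} eq = begin
    k                                      ≡⟨ transpose-involutive i j k ⟨
    PC.transpose i j (PC.transpose i j k)  ≡⟨ cong (PC.transpose i j) eq ⟩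
    PC.transpose i j (PC.transpose i j l)  ≡⟨ transpose-involutive i j l ⟩
    l                                      ∎

  ⟨$⟩ʳ-injective : ∀ (π : Permutation′ n) {i j} → π ⟨$⟩ʳ i ≡ π ⟨$⟩ʳ j → i ≡ j
  ⟨$⟩ʳ-injective π eq = trans (sym (inverseˡ π)) (trans (cong (π ⟨$⟩ˡ_) eq) (inverseˡ π))

  ⟨$⟩ˡ-injective : ∀ (π : Permutation′ n) {i j} → π ⟨$⟩ˡ i ≡ π ⟨$⟩ˡ j → i ≡ j
  ⟨$⟩ˡ-injective π eq = trans (sym (inverseʳ π)) (trans (cong (π ⟨$⟩ʳ_) eq) (inverseʳ π))

  ⟨$⟩ˡ-transpose : ∀ (u : Permutation′ n) i j p →
                   u ⟨$⟩ˡ PC.transpose (u ⟨$⟩ʳ i) (u ⟨$⟩ʳ j) p ≡ PC.transpose i j (u ⟨$⟩ˡ p)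
  ⟨$⟩ˡ-transpose u i j p = by-cases (p Fin.≟ u ⟨$⟩ʳ i) (p Fin.≟ u ⟨$⟩ʳ j)
    where
    by-cases : Dec (p ≡ u ⟨$⟩ʳ i) → Dec (p ≡ u ⟨$⟩ʳ j) →
               u ⟨$⟩ˡ PC.transpose (u ⟨$⟩ʳ i) (u ⟨$⟩ʳ j) p ≡ PC.transpose i j (u ⟨$⟩ˡ p)
    by-cases (yes refl) _ = begin
      u ⟨$⟩ˡ PC.transpose p (u ⟨$⟩ʳ j) p  ≡⟨ cong (u ⟨$⟩ˡ_) (transpose-matchˡ p (u ⟨$⟩ʳ j)) ⟩
      u ⟨$⟩ˡ (u ⟨$⟩ʳ j)                  ≡⟨ inverseˡ u ⟩
      j                                  ≡⟨ transpose-matchˡ i j ⟨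
      PC.transpose i j i                 ≡⟨ cong (PC.transpose i j) (inverseˡ u) ⟨
      PC.transpose i j (u ⟨$⟩ˡ p)        ∎
    by-cases (no _) (yes refl) = begin
      u ⟨$⟩ˡ PC.transpose (u ⟨$⟩ʳ i) p p  ≡⟨ cong (u ⟨$⟩ˡ_) (transpose-matchʳ (u ⟨$⟩ʳ i) p) ⟩
      u ⟨$⟩ˡ (u ⟨$⟩ʳ i)                  ≡⟨ inverseˡ u ⟩
      i                                  ≡⟨ transpose-matchʳ i j ⟨
      PC.transpose i j j                 ≡⟨ cong (PC.transpose i j) (inverseˡ u) ⟨
      PC.transpose i j (u ⟨$⟩ˡ p)        ∎
    by-cases (no p≢ui) (no p≢uj) = begin
      u ⟨$⟩ˡ PC.transpose (u ⟨$⟩ʳ i) (u ⟨$⟩ʳ j) p  ≡⟨ cong (u ⟨$⟩ˡ_) (transpose-other p≢ui p≢uj) ⟩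
      u ⟨$⟩ˡ p                                    ≡⟨ transpose-other (p≢ui ∘ ≡u) (p≢uj ∘ ≡u) ⟨
      PC.transpose i j (u ⟨$⟩ˡ p)                 ∎
      where
      ≡u : ∀ {k} → u ⟨$⟩ˡ p ≡ k → p ≡ u ⟨$⟩ʳ k
      ≡u eq = trans (sym (inverseʳ u)) (cong (u ⟨$⟩ʳ_) eq)

  ≡-at-remaining : ∀ (f g : Fin n → Fin n) → Injective _≡_ _≡_ f → (∀ y → ∃[ x ] g x ≡ y) →
                   ∀ a → (∀ x → x ≢ a → f x ≡ g x) → f a ≡ g a
  ≡-at-remaining f g f-injective g-surjective a f≡g with g-surjective (f a)
  ... | x , gx≡fa with x Fin.≟ a
  ...   | yes refl = sym gx≡fa
  ...   | no x≢a   = contradiction (f-injective (trans (f≡g x x≢a) gx≡fa)) x≢a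

countᵇ-tabulate : ∀ {e} {A : Set} {P : A → Set} (P? : Decidable P) (f : Fin e → A) →
                  countᵇ id (tabulate (λ i → does (P? (f i)))) ≡ length (filter P? (List.tabulate f))
countᵇ-tabulate {zero}  P? f = refl
countᵇ-tabulate {suc e} P? f with P? (f fzero)
... | yes _ = cong suc (countᵇ-tabulate P? (f ∘ fsuc))
... | no _  = countᵇ-tabulate P? (f ∘ fsuc)

Unique-lookup-injective : ∀ {A : Set} {xs : List A} → Unique xs → ∀ {k l} → List.lookup xs k ≡ List.lookup xs l → k ≡ l
Unique-lookup-injective (_ ∷ _)   {fzero}  {fzero}  _  = refl
Unique-lookup-injective (x∉ ∷ _)  {fzero}  {fsuc l} eq = contradiction eq (All.lookup x∉ (∈-lookup l))
Unique-lookup-injective (x∉ ∷ _)  {fsuc k} {fzero}  eq = contradiction (sym eq) (All.lookup x∉ (∈-lookup k))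
Unique-lookup-injective (_ ∷ xs!) {fsuc k} {fsuc l} eq = cong fsuc (Unique-lookup-injective xs! eq)

pigeonhole-∈ : ∀ {A : Set} {m} → DecidableEquality A → (f : Fin (suc m) → A) (i : Fin (suc m)) (F : List A) →
               Unique F → length F ≡ m → (∀ {x} → x ∈ F → ∃[ j ] j ≢ i × x ≡ f j) →
               ∀ j → j ≢ i → f j ∈ F
pigeonhole-∈ {m = m} _≟_ f i F F! |F|≡m F⊆f j j≢i with any? (f j ≟_) F
... | yes fj∈F = fj∈F
... | no fj∉F  = ⊥-elim (Fin.<⇒notInjective (subst (m <_) (cong suc (sym |F|≡m)) ≤-refl) index′-injective)
  where
  index : Fin (length F) → Fin (suc m)
  index k = proj₁ (F⊆f (∈-lookup k))
  i≢index : ∀ k → i ≢ index k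
  i≢index k = proj₁ (proj₂ (F⊆f (∈-lookup k))) ∘ sym
  lookup≡ : ∀ k → List.lookup F k ≡ f (index k)
  lookup≡ k = proj₂ (proj₂ (F⊆f (∈-lookup k)))
  j≢index : ∀ k → j ≢ index k
  j≢index k j≡ = fj∉F (subst (_∈ F) (trans (lookup≡ k) (cong f (sym j≡))) (∈-lookup k))
  -- Otherwise j and the positions of the elements of F are m + 1 distinct points other than i.
  index′ : Fin (suc (length F)) → Fin m
  index′ fzero    = punchOut (j≢i ∘ sym)
  index′ (fsuc k) = punchOut (i≢index k)
  index′-injective : Injective _≡_ _≡_ index′
  index′-injective {fzero}  {fzero}  _  = refl
  index′-injective {fzero}  {fsuc l} eq = contradiction (Fin.punchOut-injective (j≢i ∘ sym) (i≢index l) eq) (j≢index l)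
  index′-injective {fsuc k} {fzero}  eq = contradiction (Fin.punchOut-injective (j≢i ∘ sym) (i≢index k) (sym eq)) (j≢index k)
  index′-injective {fsuc k} {fsuc l} eq = cong fsuc (Unique-lookup-injective F!
    (trans (lookup≡ k) (trans (cong f (Fin.punchOut-injective (i≢index k) (i≢index l) eq)) (sym (lookup≡ l)))))

-- The potential of a vertex

sum-supported : ∀ {n} (f : Fin n → ℕ) i → (∀ j → j ≢ i → f j ≡ 0) → sum f ≡ f i
sum-supported {suc n} f i f≡0 = begin
  sum f                              ≡⟨ sum-remove {i = i} f ⟩
  f i + sum (λ j → f (punchIn i j))  ≡⟨ cong (f i +_) sum-rest ⟩
  f i + 0                            ≡⟨ +-identityʳ (f i) ⟩
  f i                                ∎
  where
  sum-rest : sum (λ j → f (punchIn i j)) ≡ 0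
  sum-rest = trans (sum-cong-≗ (λ j → f≡0 _ (Fin.punchInᵢ≢i i j))) (sum-replicate-zero n)

atPoint : ∀ {n} → Fin n → Fin n → ℕ
atPoint i p = if does (p Fin.≟ i) then toℕ p else 0

atPoint-here : ∀ {n} (i : Fin n) → atPoint i i ≡ toℕ i
atPoint-here i rewrite dec-true (i Fin.≟ i) refl = refl

atPoint-other : ∀ {n} {i j : Fin n} → j ≢ i → atPoint i j ≡ 0
atPoint-other {i = i} {j} j≢i rewrite dec-false (j Fin.≟ i) j≢i = refl

sum-atPoint : ∀ {n} (i : Fin n) → sum (atPoint i) ≡ toℕ i
sum-atPoint i = trans (sum-supported (atPoint i) i (λ _ → atPoint-other)) (atPoint-here i)

weight : ∀ {n} → Vec Bool n → Fin n → ℕ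
weight ε p = if lookup ε p then toℕ p else 0

weight-one : ∀ {n} (ε : Vec Bool n) p → lookup ε p ≡ true → weight ε p ≡ toℕ p
weight-one ε p = cong (λ b → if b then toℕ p else 0)

weight-zero : ∀ {n} (ε : Vec Bool n) p → lookup ε p ≡ false → weight ε p ≡ 0
weight-zero ε p = cong (λ b → if b then toℕ p else 0)

φ : ∀ {n} → Vec Bool n → ℕ
φ ε = sum (weight ε)

false≢true : false ≢ true
false≢true ()

module _ {m : ℕ} where

  private
    n : ℕ
    n = suc m

  lookup-swapAt : ∀ a (ε : Vec Bool n) p → lookup (swapAt a ε) p ≡ lookup ε (PC.transpose a (sucMod a) p)
  lookup-swapAt a ε = lookup∘tabulate (λ p → lookup ε (PC.transpose a (sucMod a) p))

  lookup-swapAt-here : ∀ a (ε : Vec Bool n) → lookup (swapAt a ε) a ≡ lookup ε (sucMod a)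
  lookup-swapAt-here a ε = trans (lookup-swapAt a ε a) (cong (lookup ε) (transpose-matchˡ a (sucMod a)))

  lookup-swapAt-next : ∀ a (ε : Vec Bool n) → lookup (swapAt a ε) (sucMod a) ≡ lookup ε a
  lookup-swapAt-next a ε = trans (lookup-swapAt a ε (sucMod a)) (cong (lookup ε) (transpose-matchʳ a (sucMod a)))

  lookup-swapAt-other : ∀ a (ε : Vec Bool n) {p} → p ≢ a → p ≢ sucMod a → lookup (swapAt a ε) p ≡ lookup ε p
  lookup-swapAt-other a ε {p} p≢a p≢Sa = trans (lookup-swapAt a ε p) (cong (lookup ε) (transpose-other p≢a p≢Sa))

  edge-label-unique : ∀ {ε ε′ : Vec Bool n} {a c} → Edge ε a ε′ → Edge ε c ε′ → a ≡ c
  edge-label-unique {ε} {a = a} {c} (εa≡true , εSa≡false , refl) (εc≡true , _ , swaps≡) with a Fin.≟ c | a Fin.≟ sucMod c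
  ... | yes a≡c | _ = a≡c
  ... | no a≢c | yes refl = contradiction (begin
    false                           ≡⟨ εSa≡false ⟨
    lookup ε (sucMod a)             ≡⟨ lookup-swapAt-here a ε ⟨
    lookup (swapAt a ε) a           ≡⟨ cong (λ δ → lookup δ a) swaps≡ ⟩
    lookup (swapAt c ε) (sucMod c)  ≡⟨ lookup-swapAt-next c ε ⟩
    lookup ε c                      ≡⟨ εc≡true ⟩
    true                            ∎) false≢true
  ... | no a≢c | no a≢Sc = contradiction (begin
    false                  ≡⟨ εSa≡false ⟨
    lookup ε (sucMod a)    ≡⟨ lookup-swapAt-here a ε ⟨
    lookup (swapAt a ε) a  ≡⟨ cong (λ δ → lookup δ a) swaps≡ ⟩
    lookup (swapAt c ε) a  ≡⟨ lookup-swapAt-other c ε a≢c a≢Sc ⟩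
    lookup ε a             ≡⟨ εa≡true ⟩
    true                   ∎) false≢true

  φ-edge : .{{NonZero m}} → ∀ {ε ε′ : Vec Bool n} {a} → Edge ε a ε′ → φ ε′ + toℕ a ≡ φ ε + toℕ (sucMod a)
  φ-edge {ε} {a = a} (εa≡true , εSa≡false , refl) = begin
    φ ε′ + toℕ a                                   ≡⟨ cong (φ ε′ +_) (sum-atPoint a) ⟨
    φ ε′ + sum (atPoint a)                         ≡⟨ ∑-distrib-+ (weight ε′) (atPoint a) ⟨
    sum (λ p → weight ε′ p + atPoint a p)          ≡⟨ sum-cong-≗ (λ p → pointwise (p Fin.≟ a) (p Fin.≟ sucMod a)) ⟩
    sum (λ p → weight ε p + atPoint (sucMod a) p)  ≡⟨ ∑-distrib-+ (weight ε) (atPoint (sucMod a)) ⟩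
    φ ε + sum (atPoint (sucMod a))                 ≡⟨ cong (φ ε +_) (sum-atPoint (sucMod a)) ⟩
    φ ε + toℕ (sucMod a)                           ∎
    where
    ε′ = swapAt a ε
    pointwise : ∀ {p} → Dec (p ≡ a) → Dec (p ≡ sucMod a) → weight ε′ p + atPoint a p ≡ weight ε p + atPoint (sucMod a) p
    pointwise (yes refl) _ = begin
      weight ε′ a + atPoint a a          ≡⟨ cong₂ _+_ (weight-zero ε′ a (trans (lookup-swapAt-here a ε) εSa≡false)) (atPoint-here a) ⟩
      toℕ a                              ≡⟨ +-identityʳ (toℕ a) ⟨
      toℕ a + 0                          ≡⟨ cong₂ _+_ (weight-one ε a εa≡true) (atPoint-other (sucMod≢ a ∘ sym)) ⟨
      weight ε a + atPoint (sucMod a) a  ∎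
    pointwise (no _) (yes refl) = begin
      weight ε′ (sucMod a) + atPoint a (sucMod a)          ≡⟨ cong₂ _+_ (weight-one ε′ (sucMod a) (trans (lookup-swapAt-next a ε) εa≡true))
                                                                        (atPoint-other (sucMod≢ a)) ⟩
      toℕ (sucMod a) + 0                                   ≡⟨ +-identityʳ _ ⟩
      toℕ (sucMod a)                                       ≡⟨ cong₂ _+_ (weight-zero ε (sucMod a) εSa≡false) (atPoint-here (sucMod a)) ⟨
      weight ε (sucMod a) + atPoint (sucMod a) (sucMod a)  ∎
    pointwise {p} (no p≢a) (no p≢Sa) =
      cong₂ _+_ (cong (λ b → if b then toℕ p else 0) (lookup-swapAt-other a ε p≢a p≢Sa))
                (trans (atPoint-other p≢a) (sym (atPoint-other p≢Sa)))

  Φ : Vec Bool n → Fin n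
  Φ ε = fzero ⊕ φ ε

  Φ-edge : .{{NonZero m}} → ∀ {ε ε′ : Vec Bool n} {a} → Edge ε a ε′ → Φ ε′ ≡ sucMod (Φ ε)
  Φ-edge {ε} {ε′} {a} edge = ⊕-cancelʳ (toℕ a) (begin
    fzero ⊕ φ ε′ ⊕ toℕ a            ≡⟨ ⊕-+ fzero (φ ε′) (toℕ a) ⟨
    fzero ⊕ (φ ε′ + toℕ a)          ≡⟨ cong (fzero ⊕_) (φ-edge {ε = ε} {ε′} edge) ⟩
    fzero ⊕ (φ ε + toℕ (sucMod a))  ≡⟨ ⊕-+ fzero (φ ε) (toℕ (sucMod a)) ⟩
    fzero ⊕ φ ε ⊕ toℕ (sucMod a)    ≡⟨ ⊕-toℕ-sucMod (fzero ⊕ φ ε) a ⟩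
    sucMod (fzero ⊕ φ ε) ⊕ toℕ a    ∎)

-- Vertices of minimal circuits

-- How the distance X of an entry changes (to X′) when the entries at
-- distances D and D + 1 are swapped.
data Moved (D : ℕ) : ℕ → ℕ → Set where
  up    : Moved D D (suc D)
  down  : Moved D (suc D) D
  fixed : ∀ {X} → X ≢ D → X ≢ suc D → Moved D X X

suc<?≡<? : ∀ {D X} → X ≢ D → X ≢ suc D → does (suc D <? X) ≡ does (D <? X)
suc<?≡<? {D} {X} X≢D X≢SD with D <? X
... | yes D<X = trans (dec-true (suc D <? X) (≤∧≢⇒< D<X (X≢SD ∘ sym))) (sym (dec-true (D <? X) D<X))
... | no  D≮X = trans (dec-false (suc D <? X) (D≮X ∘ <-trans (n<1+n D))) (sym (dec-false (D <? X) D≮X))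

<?suc≡<? : ∀ {D X} → X ≢ D → X ≢ suc D → does (X <? suc D) ≡ does (X <? D)
<?suc≡<? {D} {X} X≢D X≢SD with X <? D
... | yes X<D = trans (dec-true (X <? suc D) (m<n⇒m<1+n X<D)) (sym (dec-true (X <? D) X<D))
... | no  X≮D = trans (dec-false (X <? suc D) (λ X<SD → X≮D (≤∧≢⇒< (≤-pred X<SD) X≢D))) (sym (dec-false (X <? D) X≮D))

<?-moved : ∀ {D X X′ Y Y′} → Moved D X X′ → Moved D Y Y′ →
           ¬ (X ≡ D × Y ≡ suc D) → ¬ (X ≡ suc D × Y ≡ D) → does (X′ <? Y′) ≡ does (X <? Y)
<?-moved up               up               _ _        = refl
<?-moved up               down             ¬up-down _ = ⊥-elim (¬up-down (refl , refl))
<?-moved up               (fixed Y≢D Y≢SD) _ _        = suc<?≡<? Y≢D Y≢SD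
<?-moved down             up               _ ¬down-up = ⊥-elim (¬down-up (refl , refl))
<?-moved down             down             _ _        = refl
<?-moved down             (fixed Y≢D Y≢SD) _ _        = sym (suc<?≡<? Y≢D Y≢SD)
<?-moved (fixed X≢D X≢SD) up               _ _        = <?suc≡<? X≢D X≢SD
<?-moved (fixed X≢D X≢SD) down             _ _        = sym (<?suc≡<? X≢D X≢SD)
<?-moved (fixed _ _)      (fixed _ _)      _ _        = refl

module _ {m : ℕ} where

  private
    n : ℕ
    n = suc m

  -- pos p is the position of the label p in the word (pos = u⁻¹ for vertex u).
  -- A one at p leaves by the edge p and arrives by the edge p - 1.
  vertexBy : (Fin n → Fin n) → Fin n → Vec Bool n
  vertexBy pos j = tabulate λ p → does (dist j (pos p) <? dist j (pos (predMod p)))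

  vertex : Permutation′ n → Fin n → Vec Bool n
  vertex u = vertexBy (u ⟨$⟩ˡ_)

  module _ (pos : Fin n → Fin n) (j : Fin n) where

    lookup-vertexBy : ∀ p → lookup (vertexBy pos j) p ≡ does (dist j (pos p) <? dist j (pos (predMod p)))
    lookup-vertexBy = lookup∘tabulate (λ p → does (dist j (pos p) <? dist j (pos (predMod p))))

    vertexBy-one-at-start : ∀ p → pos p ≡ j → pos (predMod p) ≢ j → lookup (vertexBy pos j) p ≡ true
    vertexBy-one-at-start p refl pos′≢j = begin
      lookup (vertexBy pos j) p                    ≡⟨ lookup-vertexBy p ⟩
      does (dist j j <? dist j (pos (predMod p)))  ≡⟨ cong (λ x → does (x <? dist j (pos (predMod p)))) (dist-refl j) ⟩
      does (0 <? dist j (pos (predMod p)))         ≡⟨ dec-true (0 <? _) (n≢0⇒n>0 (pos′≢j ∘ sym ∘ dist≡0⇒≡)) ⟩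
      true                                         ∎

    vertexBy-zero-after-start : ∀ p → pos (predMod p) ≡ j → lookup (vertexBy pos j) p ≡ false
    vertexBy-zero-after-start p refl = begin
      lookup (vertexBy pos j) p          ≡⟨ lookup-vertexBy p ⟩
      does (dist j (pos p) <? dist j j)  ≡⟨ cong (λ x → does (dist j (pos p) <? x)) (dist-refl j) ⟩
      does (dist j (pos p) <? 0)         ≡⟨ dec-false (dist j (pos p) <? 0) (λ ()) ⟩
      false                              ∎

    vertexBy-zero-at-end : ∀ p → sucMod (pos p) ≡ j → lookup (vertexBy pos j) p ≡ false
    vertexBy-zero-at-end p refl = begin
      lookup (vertexBy pos j) p                          ≡⟨ lookup-vertexBy p ⟩
      does (dist j (pos p) <? dist j (pos (predMod p)))  ≡⟨ cong (λ x → does (x <? dist j (pos (predMod p)))) (dist-sucMod-self (pos p)) ⟩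
      does (m <? dist j (pos (predMod p)))               ≡⟨ dec-false (m <? _) (λ m<d → <⇒≱ m<d (≤-pred (dist< j (pos (predMod p))))) ⟩
      false                                              ∎

    vertexBy-one-after-end : ∀ p → sucMod (pos (predMod p)) ≡ j → sucMod (pos p) ≢ j → lookup (vertexBy pos j) p ≡ true
    vertexBy-one-after-end p refl Spos≢j = begin
      lookup (vertexBy pos j) p                          ≡⟨ lookup-vertexBy p ⟩
      does (dist j (pos p) <? dist j (pos (predMod p)))  ≡⟨ cong (λ x → does (dist j (pos p) <? x)) (dist-sucMod-self (pos (predMod p))) ⟩
      does (dist j (pos p) <? m)                         ≡⟨ dec-true (_ <? m) (≤∧≢⇒< (≤-pred (dist< j (pos p))) dist≢m) ⟩
      true                                               ∎
      where
      dist≢m : dist j (pos p) ≢ m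
      dist≢m eq = Spos≢j (cong sucMod (dist-injective j (trans eq (sym (dist-sucMod-self (pos (predMod p)))))))

  vertexBy-⊕ : ∀ {pos pos′ : Fin n → Fin n} h → (∀ p → pos′ p ≡ pos p ⊕ h) → ∀ j → vertexBy pos′ (j ⊕ h) ≡ vertexBy pos j
  vertexBy-⊕ {pos} {pos′} h pos′≡ j = tabulate-cong λ p → cong₂ (λ x y → does (x <? y)) (rotated p) (rotated (predMod p))
    where
    rotated : ∀ p → dist (j ⊕ h) (pos′ p) ≡ dist j (pos p)
    rotated p = trans (cong (dist (j ⊕ h)) (pos′≡ p)) (dist-⊕-invariant j (pos p) h)

  module _ {j J : Fin n} (j≢SJ : j ≢ sucMod J) where

    private
      σ : Fin n → Fin n
      σ = PC.transpose J (sucMod J)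

      dist-SJ : dist j (sucMod J) ≡ suc (dist j J)
      dist-SJ = dist-sucModʳ j J (j≢SJ ∘ sym)

    dist-transpose-moved : ∀ z → Moved (dist j J) (dist j z) (dist j (σ z))
    dist-transpose-moved z = by-cases (z Fin.≟ J) (z Fin.≟ sucMod J)
      where
      by-cases : Dec (z ≡ J) → Dec (z ≡ sucMod J) → Moved (dist j J) (dist j z) (dist j (σ z))
      by-cases (yes refl) _ =
        subst (Moved (dist j z) (dist j z)) (trans (sym dist-SJ) (cong (dist j) (sym (transpose-matchˡ z (sucMod z))))) up
      by-cases (no _) (yes refl) =
        subst₂ (Moved (dist j J)) (sym dist-SJ) (cong (dist j) (sym (transpose-matchʳ J z))) down
      by-cases (no z≢J) (no z≢SJ) =
        subst (Moved (dist j J) (dist j z)) (cong (dist j) (sym (transpose-other z≢J z≢SJ)))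
          (fixed (z≢J ∘ dist-injective j) (λ eq → z≢SJ (dist-injective j (trans eq (sym dist-SJ)))))

    vertexBy-transpose : ∀ (pos : Fin n → Fin n) →
                         (∀ p → pos p ≡ J → pos (predMod p) ≢ sucMod J) → (∀ p → pos p ≡ sucMod J → pos (predMod p) ≢ J) →
                         vertexBy (σ ∘ pos) j ≡ vertexBy pos j
    vertexBy-transpose pos ¬J-SJ ¬SJ-J = tabulate-cong λ p →
      <?-moved (dist-transpose-moved (pos p)) (dist-transpose-moved (pos (predMod p)))
        (λ (x≡ , y≡) → ¬J-SJ p (dist-injective j x≡) (dist-injective j (trans y≡ (sym dist-SJ))))
        (λ (x≡ , y≡) → ¬SJ-J p (dist-injective j (trans x≡ (sym dist-SJ))) (dist-injective j y≡))

  labelsFrom : Permutation′ n → Fin n → ℕ → List (Fin n)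
  labelsFrom u j e = map (u ⟨$⟩ʳ_) (List.iterate sucMod j e)

  tabulate≡iterate : ∀ {e} (f : Fin e → Fin n) i → (∀ k → f k ≡ i ⊕ toℕ k) → List.tabulate f ≡ List.iterate sucMod i e
  tabulate≡iterate {zero}  f i f≡ = refl
  tabulate≡iterate {suc e} f i f≡ = cong₂ _∷_ (f≡ fzero) (tabulate≡iterate (f ∘ fsuc) (sucMod i) (f≡ ∘ fsuc))

  allFin≡iterate : allFin n ≡ List.iterate sucMod fzero n
  allFin≡iterate = tabulate≡iterate id fzero (sym ∘ fzero⊕toℕ)

  labels≡labelsFrom : ∀ u → labels u ≡ labelsFrom u fzero n
  labels≡labelsFrom u = cong (map (u ⟨$⟩ʳ_)) allFin≡iterate

  module _ .{{_ : NonZero m}} (u : Permutation′ n) where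

    private
      pos : Fin n → Fin n
      pos = u ⟨$⟩ˡ_

      pos≡⇒≡ : ∀ {p j} → pos p ≡ j → p ≡ u ⟨$⟩ʳ j
      pos≡⇒≡ eq = trans (sym (inverseʳ u)) (cong (u ⟨$⟩ʳ_) eq)

      predMod≡⇒≡ : ∀ {p a : Fin n} → predMod p ≡ a → p ≡ sucMod a
      predMod≡⇒≡ {p} eq = trans (sym (sucMod-predMod p)) (cong sucMod eq)

    vertex-one-at-label : ∀ j → lookup (vertex u j) (u ⟨$⟩ʳ j) ≡ true
    vertex-one-at-label j = vertexBy-one-at-start pos j (u ⟨$⟩ʳ j) (inverseˡ u) (predMod≢ (u ⟨$⟩ʳ j) ∘ pos≡⇒≡)

    vertex-zero-after-label : ∀ j → lookup (vertex u j) (sucMod (u ⟨$⟩ʳ j)) ≡ false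
    vertex-zero-after-label j = vertexBy-zero-after-start pos j (sucMod (u ⟨$⟩ʳ j)) (trans (cong pos (predMod-sucMod _)) (inverseˡ u))

    vertex-sucMod : ∀ j → vertex u (sucMod j) ≡ swapAt (u ⟨$⟩ʳ j) (vertex u j)
    vertex-sucMod j = begin
      vertex u (sucMod j)                        ≡⟨ tabulate∘lookup _ ⟨
      tabulate (lookup (vertex u (sucMod j)))    ≡⟨ tabulate-cong (λ p → by-cases (p Fin.≟ a) (p Fin.≟ sucMod a)) ⟩
      tabulate (lookup (swapAt a (vertex u j)))  ≡⟨ tabulate∘lookup _ ⟩
      swapAt a (vertex u j)                      ∎
      where
      a = u ⟨$⟩ʳ j
      by-cases : ∀ {p} → Dec (p ≡ a) → Dec (p ≡ sucMod a) → lookup (vertex u (sucMod j)) p ≡ lookup (swapAt a (vertex u j)) p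
      by-cases (yes refl) _ = begin
        lookup (vertex u (sucMod j)) a    ≡⟨ vertexBy-zero-at-end pos (sucMod j) a (cong sucMod (inverseˡ u)) ⟩
        false                             ≡⟨ vertex-zero-after-label j ⟨
        lookup (vertex u j) (sucMod a)    ≡⟨ lookup-swapAt-here a (vertex u j) ⟨
        lookup (swapAt a (vertex u j)) a  ∎
      by-cases (no _) (yes refl) = begin
        lookup (vertex u (sucMod j)) (sucMod a)    ≡⟨ vertexBy-one-after-end pos (sucMod j) (sucMod a)
                                                        (cong sucMod (trans (cong pos (predMod-sucMod a)) (inverseˡ u)))
                                                        (sucMod≢ a ∘ pos≡⇒≡ ∘ sucMod-injective) ⟩
        true                                       ≡⟨ vertex-one-at-label j ⟨
        lookup (vertex u j) a                      ≡⟨ lookup-swapAt-next a (vertex u j) ⟨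
        lookup (swapAt a (vertex u j)) (sucMod a)  ∎
      by-cases {p} (no p≢a) (no p≢Sa) = begin
        lookup (vertex u (sucMod j)) p                                       ≡⟨ lookup-vertexBy pos (sucMod j) p ⟩
        does (dist (sucMod j) (pos p) <? dist (sucMod j) (pos (predMod p)))  ≡⟨ cong₂ (λ x y → does (x <? y))
                                                                                  (dist-sucModˡ j (pos p) (p≢a ∘ pos≡⇒≡))
                                                                                  (dist-sucModˡ j (pos (predMod p)) (p≢Sa ∘ predMod≡⇒≡ ∘ pos≡⇒≡)) ⟨
        does (dist j (pos p) <? dist j (pos (predMod p)))                    ≡⟨ lookup-vertexBy pos j p ⟨
        lookup (vertex u j) p                                                ≡⟨ lookup-swapAt-other a (vertex u j) p≢a p≢Sa ⟨
        lookup (swapAt a (vertex u j)) p                                     ∎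

    vertex-edge : ∀ j → Edge (vertex u j) (u ⟨$⟩ʳ j) (vertex u (sucMod j))
    vertex-edge j = vertex-one-at-label j , vertex-zero-after-label j , vertex-sucMod j

    Φ-vertex-sucMod : ∀ j → Φ (vertex u (sucMod j)) ≡ sucMod (Φ (vertex u j))
    Φ-vertex-sucMod j = Φ-edge {ε = vertex u j} {vertex u (sucMod j)} (vertex-edge j)

    Φ-vertex-injective : ∀ {i j} → Φ (vertex u i) ≡ Φ (vertex u j) → i ≡ j
    Φ-vertex-injective = sucMod-homomorphic⇒injective Φ-vertex-sucMod

    vertex-injective : ∀ {i j} → vertex u i ≡ vertex u j → i ≡ j
    vertex-injective = Φ-vertex-injective ∘ cong Φ

    walkFrom : ∀ e j → Walk (vertex u j) (labelsFrom u j e) (vertex u (j ⊕ e))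
    walkFrom zero    j = []
    walkFrom (suc e) j = vertex-edge j ∷ walkFrom e (sucMod j)

    visited-walk : ∀ e {j ε ε′} → ε ≡ vertex u j → (q : Walk ε (labelsFrom u j e) ε′) →
                   visited q ≡ map (vertex u) (List.iterate sucMod j e)
    visited-walk zero    refl []           = refl
    visited-walk (suc e) {j} refl (edge ∷ q) =
      cong (vertex u j ∷_) (visited-walk e (trans (proj₂ (proj₂ edge)) (sym (vertex-sucMod j))) q)

    walk-start-lookup : ∀ e {j ε ε′} → Walk ε (labelsFrom u j e) ε′ →
                        ∀ p → dist j (pos p) < e → dist j (pos (predMod p)) < e → lookup ε p ≡ lookup (vertex u j) p
    walk-start-lookup zero    _ p () _
    walk-start-lookup (suc e) {j} {ε} (_∷_ {ε' = ε₁} edge q) p p<e p′<e = by-cases (p Fin.≟ a) (p Fin.≟ sucMod a)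
      where
      a = u ⟨$⟩ʳ j
      later : ∀ {x} → x ≢ j → dist j x < suc e → dist (sucMod j) x < e
      later {x} x≢j x<e = ≤-pred (subst (_< suc e) (dist-sucModˡ j x x≢j) x<e)
      by-cases : Dec (p ≡ a) → Dec (p ≡ sucMod a) → lookup ε p ≡ lookup (vertex u j) p
      by-cases (yes refl) _       = trans (proj₁ edge) (sym (vertex-one-at-label j))
      by-cases (no _) (yes refl)  = trans (proj₁ (proj₂ edge)) (sym (vertex-zero-after-label j))
      by-cases (no p≢a) (no p≢Sa) = begin
        lookup ε p                        ≡⟨ lookup-swapAt-other a ε p≢a p≢Sa ⟨
        lookup (swapAt a ε) p             ≡⟨ cong (λ δ → lookup δ p) (proj₂ (proj₂ edge)) ⟨
        lookup ε₁ p                       ≡⟨ walk-start-lookup e q p (later (p≢a ∘ pos≡⇒≡) p<e)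
                                                                     (later (p≢Sa ∘ predMod≡⇒≡ ∘ pos≡⇒≡) p′<e) ⟩
        lookup (vertex u (sucMod j)) p    ≡⟨ cong (λ δ → lookup δ p) (vertex-sucMod j) ⟩
        lookup (swapAt a (vertex u j)) p  ≡⟨ lookup-swapAt-other a (vertex u j) p≢a p≢Sa ⟩
        lookup (vertex u j) p             ∎

    walk-start : ∀ {ε ε′} → Walk ε (labels u) ε′ → ε ≡ vertex u fzero
    walk-start {ε} {ε′} q = begin
      ε                                   ≡⟨ tabulate∘lookup ε ⟨
      tabulate (lookup ε)                 ≡⟨ tabulate-cong (λ p → walk-start-lookup n q′ p (dist< fzero (pos p)) (dist< fzero (pos (predMod p)))) ⟩
      tabulate (lookup (vertex u fzero))  ≡⟨ tabulate∘lookup _ ⟩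
      vertex u fzero                      ∎
      where
      q′ = subst (λ ls → Walk ε ls ε′) (labels≡labelsFrom u) q

    visited-circuit : ∀ {ε′} (q : Walk (vertex u fzero) (labels u) ε′) → visited q ≡ map (vertex u) (allFin n)
    visited-circuit = go (labels≡labelsFrom u)
      where
      go : ∀ {ls ε′} → ls ≡ labelsFrom u fzero n → (q : Walk (vertex u fzero) ls ε′) → visited q ≡ map (vertex u) (allFin n)
      go refl q = trans (visited-walk n refl q) (cong (map (vertex u)) (sym allFin≡iterate))

    isVertex⇒vertex : ∀ {k ε} → IsVertex k u ε → ∃[ y ] ε ≡ vertex u y
    isVertex⇒vertex {ε = ε} (_ , _ , q , ε∈) with refl ← walk-start q
      with y , _ , ε≡ ← ∈-map⁻ (vertex u) {xs = allFin n} (subst (ε ∈_) (visited-circuit q) ε∈) = y , ε≡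

    vertex⇒isVertex : ∀ {k} → ones (vertex u fzero) ≡ k → ∀ y → IsVertex k u (vertex u y)
    vertex⇒isVertex ones≡k y =
      vertex u fzero , ones≡k , circuit , subst (vertex u y ∈_) (sym (visited-circuit circuit)) (∈-map⁺ (vertex u) (∈-allFin y))
      where
      circuit : Walk (vertex u fzero) (labels u) (vertex u fzero)
      circuit = subst₂ (Walk (vertex u fzero)) (sym (labels≡labelsFrom u)) (cong (vertex u) (⊕-period fzero)) (walkFrom n fzero)

    ones-vertex : ∀ {k} → InC k n u → 0 < k → ones (vertex u fzero) ≡ k
    ones-vertex {k} (last-fixed , descents≡) 0<k = begin
      ones (vertex u fzero)
        ≡⟨ cong (λ b → (if b then suc else id) (countᵇ id (tabulate (bit ∘ fsuc)))) first-bit ⟩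
      suc (countᵇ id (tabulate (bit ∘ fsuc)))
        ≡⟨ cong (suc ∘ countᵇ id) (tabulate-cong λ q →
             cong₂ (λ x y → does (x <? y)) (dist-fzero (pos (fsuc q))) (dist-fzero (pos (inject₁ q)))) ⟩
      suc (countᵇ id (tabulate (λ q → does (pos (fsuc q) Fin.<? pos (inject₁ q)))))
        ≡⟨ cong suc (countᵇ-tabulate (λ q → pos (fsuc q) Fin.<? pos (inject₁ q)) id) ⟩
      suc (descents pos)
        ≡⟨ cong suc descents≡ ⟩
      suc (k ∸ 1)
        ≡⟨ m+[n∸m]≡n 0<k ⟩
      k ∎
      where
      bit : Fin n → Bool
      bit p = does (dist fzero (pos p) <? dist fzero (pos (predMod p)))
      S-last : sucMod (pos (predMod fzero)) ≡ fzero
      S-last = trans (cong (sucMod ∘ pos) (sym last-fixed)) (trans (cong sucMod (inverseˡ u)) (sucMod-predMod fzero))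
      first-bit : bit fzero ≡ true
      first-bit = vertexBy-one-after-end pos fzero fzero S-last S-first≢
        where
        S-first≢ : sucMod (pos fzero) ≢ fzero
        S-first≢ eq = predMod≢ fzero (⟨$⟩ˡ-injective u (sucMod-injective (trans S-last (sym eq))))

-- Shared facets

module _ {m : ℕ} where

  private
    n : ℕ
    n = suc m

  OnlyUnshared : Permutation′ n → Permutation′ n → Fin n → Set
  OnlyUnshared u w i = (∀ z → vertex u i ≢ vertex w z) × (∀ y → y ≢ i → ∃[ z ] vertex u y ≡ vertex w z)

  module _ .{{_ : NonZero m}} {k} (u w : Permutation′ n)
           (ones-u : ones (vertex u fzero) ≡ k) (ones-w : ones (vertex w fzero) ≡ k) where

    sharesFacet⇒onlyUnshared : SharesFacet k u w → ∃[ i ] OnlyUnshared u w i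
    sharesFacet⇒onlyUnshared ((ε , ε∈u , ε∉w) , F , |F|≡m , F! , F⊆) with i , refl ← isVertex⇒vertex u ε∈u =
      i , unshared , shared
      where
      unshared : ∀ z → vertex u i ≢ vertex w z
      unshared z eq = ε∉w (subst (IsVertex k w) (sym eq) (vertex⇒isVertex w ones-w z))
      F⊆vertex : ∀ {ε} → ε ∈ F → ∃[ x ] x ≢ i × ε ≡ vertex u x
      F⊆vertex ε∈F with x , refl ← isVertex⇒vertex u (proj₁ (All.lookup F⊆ ε∈F))
                  with z , ε≡ ← isVertex⇒vertex w (proj₂ (All.lookup F⊆ ε∈F)) =
        x , (λ { refl → unshared z ε≡ }) , refl
      shared : ∀ y → y ≢ i → ∃[ z ] vertex u y ≡ vertex w z
      shared y y≢i = isVertex⇒vertex w (proj₂ (All.lookup F⊆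
        (pigeonhole-∈ (≡-dec Bool._≟_) (vertex u) i F F! |F|≡m F⊆vertex y y≢i)))

    onlyUnshared⇒sharesFacet : ∀ {i} → OnlyUnshared u w i → SharesFacet k u w
    onlyUnshared⇒sharesFacet {i} (unshared , shared) =
      (vertex u i , vertex⇒isVertex u ones-u i , vertex-unshared) , F , |F|≡m , F! , All.tabulate F-shared
      where
      vertex-unshared : ¬ IsVertex k w (vertex u i)
      vertex-unshared ε∈w = let z , eq = isVertex⇒vertex w ε∈w in unshared z eq
      F : List (Vec Bool n)
      F = map (vertex u ∘ punchIn i) (allFin m)
      |F|≡m : length F ≡ m
      |F|≡m = trans (length-map _ (allFin m)) (length-tabulate id)
      F! : Unique F
      F! = Unique.map⁺ (Fin.punchIn-injective i _ _ ∘ vertex-injective u) (Unique.allFin⁺ m)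
      F-shared : ∀ {ε} → ε ∈ F → IsVertex k u ε × IsVertex k w ε
      F-shared ε∈F with j , _ , refl ← ∈-map⁻ (vertex u ∘ punchIn i) ε∈F
                   with z , eq ← shared (punchIn i j) (Fin.punchInᵢ≢i i j) =
        vertex⇒isVertex u ones-u (punchIn i j) , subst (IsVertex k w) (sym eq) (vertex⇒isVertex w ones-w z)

    sharesFacet⇔onlyUnshared : SharesFacet k u w ⇔ (∃[ i ] OnlyUnshared u w i)
    sharesFacet⇔onlyUnshared = mk⇔ sharesFacet⇒onlyUnshared (onlyUnshared⇒sharesFacet ∘ proj₂)

-- Switching two entries of a word

module _ {m : ℕ} where

  private
    n : ℕ
    n = suc m

  cyc-label : ∀ (u : Permutation′ n) j → cyc u (u ⟨$⟩ʳ j) ≡ u ⟨$⟩ʳ sucMod j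
  cyc-label u j = cong (λ i → u ⟨$⟩ʳ sucMod i) (inverseˡ u)

  cyc-injective : ∀ (u : Permutation′ n) {x y} → cyc u x ≡ cyc u y → x ≡ y
  cyc-injective u = ⟨$⟩ˡ-injective u ∘ sucMod-injective ∘ ⟨$⟩ʳ-injective u

  cyc-surjective : ∀ (u : Permutation′ n) y → ∃[ x ] cyc u x ≡ y
  cyc-surjective u y = u ⟨$⟩ʳ predMod (u ⟨$⟩ˡ y) , (begin
    cyc u (u ⟨$⟩ʳ predMod (u ⟨$⟩ˡ y))   ≡⟨ cyc-label u (predMod (u ⟨$⟩ˡ y)) ⟩
    u ⟨$⟩ʳ sucMod (predMod (u ⟨$⟩ˡ y))  ≡⟨ cong (u ⟨$⟩ʳ_) (sucMod-predMod (u ⟨$⟩ˡ y)) ⟩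
    u ⟨$⟩ʳ (u ⟨$⟩ˡ y)                   ≡⟨ inverseʳ u ⟩
    y                                   ∎)

  conjugate⇒rotation : ∀ (u w : Permutation′ n) (t : Fin n → Fin n) → (∀ x → t (t x) ≡ x) →
                       (∀ x → cyc w x ≡ t (cyc u (t x))) →
                       ∀ h J → w ⟨$⟩ʳ (J ⊕ h) ≡ t (u ⟨$⟩ʳ J) → ∀ x → w ⟨$⟩ʳ (x ⊕ h) ≡ t (u ⟨$⟩ʳ x)
  conjugate⇒rotation u w t t-involutive w≡tut h J wJh≡tuJ x =
    subst (λ y → w ⟨$⟩ʳ (y ⊕ h) ≡ t (u ⟨$⟩ʳ y)) (⊕-dist J x) (along (dist J x) J wJh≡tuJ)
    where
    along : ∀ e i → w ⟨$⟩ʳ (i ⊕ h) ≡ t (u ⟨$⟩ʳ i) → w ⟨$⟩ʳ (i ⊕ e ⊕ h) ≡ t (u ⟨$⟩ʳ (i ⊕ e))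
    along zero    i eq = eq
    along (suc e) i eq = along e (sucMod i) (begin
      w ⟨$⟩ʳ (i ⊕ suc h)              ≡⟨ cong (w ⟨$⟩ʳ_) (⊕-suc i h) ⟩
      w ⟨$⟩ʳ sucMod (i ⊕ h)           ≡⟨ cyc-label w (i ⊕ h) ⟨
      cyc w (w ⟨$⟩ʳ (i ⊕ h))          ≡⟨ w≡tut _ ⟩
      t (cyc u (t (w ⟨$⟩ʳ (i ⊕ h))))  ≡⟨ cong (t ∘ cyc u ∘ t) eq ⟩
      t (cyc u (t (t (u ⟨$⟩ʳ i))))    ≡⟨ cong (t ∘ cyc u) (t-involutive _) ⟩
      t (cyc u (u ⟨$⟩ʳ i))            ≡⟨ cong t (cyc-label u i) ⟩
      t (u ⟨$⟩ʳ sucMod i)             ∎)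

  IsSwitch : Permutation′ n → Permutation′ n → Fin n → Fin n → Set
  IsSwitch u w a b = ¬ (sucMod b ≡ a) × ¬ (sucMod a ≡ b)
                   × (∀ x → cyc w x ≡ transpose a b ⟨$⟩ʳ (cyc u (transpose a b ⟨$⟩ʳ x)))

  module _ .{{_ : NonZero m}} (u w : Permutation′ n) (J : Fin n) (only : OnlyUnshared u w (sucMod J)) where

    private
      a = u ⟨$⟩ʳ J
      b = u ⟨$⟩ʳ sucMod J
      t = PC.transpose a b
      unshared = proj₁ only
      shared = proj₂ only

      l = proj₁ (shared J (sucMod≢ J ∘ sym))
      uJ≡wl : vertex u J ≡ vertex w l
      uJ≡wl = proj₂ (shared J (sucMod≢ J ∘ sym))

      u-position : ∀ c → c ≡ u ⟨$⟩ʳ (u ⟨$⟩ˡ c)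
      u-position c = sym (inverseʳ u)

    Φ-next : ∀ j l′ → vertex u j ≡ vertex w l′ → Φ (vertex w (sucMod l′)) ≡ Φ (vertex u (sucMod j))
    Φ-next j l′ eq = begin
      Φ (vertex w (sucMod l′))  ≡⟨ Φ-vertex-sucMod w l′ ⟩
      sucMod (Φ (vertex w l′))  ≡⟨ cong (sucMod ∘ Φ) eq ⟨
      sucMod (Φ (vertex u j))   ≡⟨ Φ-vertex-sucMod u j ⟨
      Φ (vertex u (sucMod j))   ∎

    shared-edge : ∀ j l′ → vertex u j ≡ vertex w l′ → j ≢ J →
                  w ⟨$⟩ʳ l′ ≡ u ⟨$⟩ʳ j × vertex w (sucMod l′) ≡ vertex u (sucMod j)
    shared-edge j l′ eq j≢J =
      edge-label-unique {ε = vertex w l′} (vertex-edge w l′) (subst₂ (λ ε ε′ → Edge ε (u ⟨$⟩ʳ j) ε′) eq next≡′ (vertex-edge u j)) ,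
      sym next≡′
      where
      next-shared = shared (sucMod j) (j≢J ∘ sucMod-injective)
      z≡Sl′ : proj₁ next-shared ≡ sucMod l′
      z≡Sl′ = Φ-vertex-injective w (trans (cong Φ (sym (proj₂ next-shared))) (sym (Φ-next j l′ eq)))
      next≡′ : vertex u (sucMod j) ≡ vertex w (sucMod l′)
      next≡′ = trans (proj₂ next-shared) (cong (vertex w) z≡Sl′)

    edge-shared : ∀ j → j ≢ J → j ≢ sucMod J →
                  vertex w (w ⟨$⟩ˡ (u ⟨$⟩ʳ j)) ≡ vertex u j × vertex w (sucMod (w ⟨$⟩ˡ (u ⟨$⟩ʳ j))) ≡ vertex u (sucMod j)
    edge-shared j j≢J j≢SJ =
      subst (λ z → vertex w z ≡ vertex u j × vertex w (sucMod z) ≡ vertex u (sucMod j))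
            (trans (sym (inverseˡ w)) (cong (w ⟨$⟩ˡ_) (proj₁ edge))) (sym (proj₂ j-shared) , proj₂ edge)
      where
      j-shared = shared j j≢SJ
      edge = shared-edge j (proj₁ j-shared) (proj₂ j-shared) j≢J

    wl≡b : w ⟨$⟩ʳ l ≡ b
    wl≡b = by-cases (j Fin.≟ J) (j Fin.≟ sucMod J)
      where
      c = w ⟨$⟩ʳ l
      j = u ⟨$⟩ˡ c
      by-cases : Dec (j ≡ J) → Dec (j ≡ sucMod J) → c ≡ b
      by-cases (yes j≡J) _ = ⊥-elim (unshared (sucMod l) (begin
        vertex u (sucMod J)    ≡⟨ vertex-sucMod u J ⟩
        swapAt a (vertex u J)  ≡⟨ cong₂ swapAt (trans (cong (u ⟨$⟩ʳ_) (sym j≡J)) (sym (u-position c))) uJ≡wl ⟩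
        swapAt c (vertex w l)  ≡⟨ vertex-sucMod w l ⟨
        vertex w (sucMod l)    ∎))
      by-cases (no _) (yes j≡SJ) = trans (u-position c) (cong (u ⟨$⟩ʳ_) j≡SJ)
      by-cases (no j≢J) (no j≢SJ) = ⊥-elim (j≢J (vertex-injective u (begin
        vertex u j                    ≡⟨ proj₁ (edge-shared j j≢J j≢SJ) ⟨
        vertex w (w ⟨$⟩ˡ (u ⟨$⟩ʳ j))  ≡⟨ cong (vertex w ∘ (w ⟨$⟩ˡ_)) (u-position c) ⟨
        vertex w (w ⟨$⟩ˡ c)           ≡⟨ cong (vertex w) (inverseˡ w) ⟩
        vertex w l                    ≡⟨ uJ≡wl ⟨
        vertex u J                    ∎)))

    wSl≡a : w ⟨$⟩ʳ sucMod l ≡ a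
    wSl≡a = by-cases (j Fin.≟ J) (j Fin.≟ sucMod J)
      where
      c = w ⟨$⟩ʳ sucMod l
      j = u ⟨$⟩ˡ c
      by-cases : Dec (j ≡ J) → Dec (j ≡ sucMod J) → c ≡ a
      by-cases (yes j≡J) _ = trans (u-position c) (cong (u ⟨$⟩ʳ_) j≡J)
      by-cases (no _) (yes j≡SJ) =
        ⊥-elim (sucMod≢ l (⟨$⟩ʳ-injective w (trans (trans (u-position c) (cong (u ⟨$⟩ʳ_) j≡SJ)) (sym wl≡b))))
      by-cases (no j≢J) (no j≢SJ) = ⊥-elim (j≢SJ (Φ-vertex-injective u (begin
        Φ (vertex u j)                    ≡⟨ cong Φ (proj₁ (edge-shared j j≢J j≢SJ)) ⟨
        Φ (vertex w (w ⟨$⟩ˡ (u ⟨$⟩ʳ j)))  ≡⟨ cong (Φ ∘ vertex w ∘ (w ⟨$⟩ˡ_)) (u-position c) ⟨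
        Φ (vertex w (w ⟨$⟩ˡ c))           ≡⟨ cong (Φ ∘ vertex w) (inverseˡ w) ⟩
        Φ (vertex w (sucMod l))           ≡⟨ Φ-next J l uJ≡wl ⟩
        Φ (vertex u (sucMod J))           ∎)))

    cyc-switch-b : cyc w b ≡ t (cyc u (t b))
    cyc-switch-b = begin
      w ⟨$⟩ʳ sucMod (w ⟨$⟩ˡ b)           ≡⟨ cong (λ c → w ⟨$⟩ʳ sucMod (w ⟨$⟩ˡ c)) wl≡b ⟨
      w ⟨$⟩ʳ sucMod (w ⟨$⟩ˡ (w ⟨$⟩ʳ l))  ≡⟨ cong (λ i → w ⟨$⟩ʳ sucMod i) (inverseˡ w) ⟩
      w ⟨$⟩ʳ sucMod l                    ≡⟨ wSl≡a ⟩
      a                                  ≡⟨ transpose-matchʳ a b ⟨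
      t b                                ≡⟨ cong t (cyc-label u J) ⟨
      t (cyc u a)                        ≡⟨ cong (t ∘ cyc u) (transpose-matchʳ a b) ⟨
      t (cyc u (t b))                    ∎

    cyc-switch-other : ∀ x → x ≢ a → x ≢ b → cyc w x ≡ t (cyc u (t x))
    cyc-switch-other x x≢a x≢b = begin
      cyc w x               ≡⟨ by-cases (sucMod j Fin.≟ J) ⟩
      t (u ⟨$⟩ʳ sucMod j)   ≡⟨ cong t (cyc-label u j) ⟨
      t (cyc u (u ⟨$⟩ʳ j))  ≡⟨ cong (t ∘ cyc u) (u-position x) ⟨
      t (cyc u x)           ≡⟨ cong (t ∘ cyc u) (transpose-other x≢a x≢b) ⟨
      t (cyc u (t x))       ∎
      where
      j = u ⟨$⟩ˡ x
      j≢J : j ≢ J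
      j≢J j≡J = x≢a (trans (u-position x) (cong (u ⟨$⟩ʳ_) j≡J))
      j≢SJ : j ≢ sucMod J
      j≢SJ j≡SJ = x≢b (trans (u-position x) (cong (u ⟨$⟩ʳ_) j≡SJ))
      lx = w ⟨$⟩ˡ x
      next≡ : vertex w (sucMod lx) ≡ vertex u (sucMod j)
      next≡ = subst (λ c → vertex w (sucMod (w ⟨$⟩ˡ c)) ≡ vertex u (sucMod j)) (sym (u-position x))
                    (proj₂ (edge-shared j j≢J j≢SJ))
      by-cases : Dec (sucMod j ≡ J) → cyc w x ≡ t (u ⟨$⟩ʳ sucMod j)
      by-cases (yes Sj≡J) = begin
        w ⟨$⟩ʳ sucMod lx     ≡⟨ cong (w ⟨$⟩ʳ_) (vertex-injective w (trans next≡ (trans (cong (vertex u) Sj≡J) uJ≡wl))) ⟩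
        w ⟨$⟩ʳ l             ≡⟨ wl≡b ⟩
        b                    ≡⟨ transpose-matchˡ a b ⟨
        t a                  ≡⟨ cong (t ∘ (u ⟨$⟩ʳ_)) Sj≡J ⟨
        t (u ⟨$⟩ʳ sucMod j)  ∎
      by-cases (no Sj≢J) = begin
        w ⟨$⟩ʳ sucMod lx                   ≡⟨ cong (w ⟨$⟩ʳ_) (vertex-injective w (trans (proj₁ next-label) (sym next≡))) ⟨
        w ⟨$⟩ʳ (w ⟨$⟩ˡ (u ⟨$⟩ʳ sucMod j))  ≡⟨ inverseʳ w ⟩
        u ⟨$⟩ʳ sucMod j                    ≡⟨ transpose-other (Sj≢J ∘ ⟨$⟩ʳ-injective u) (j≢J ∘ sucMod-injective ∘ ⟨$⟩ʳ-injective u) ⟨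
        t (u ⟨$⟩ʳ sucMod j)                ∎
        where
        next-label = edge-shared (sucMod j) Sj≢J (j≢J ∘ sucMod-injective)

    cyc-switch-≢a : ∀ x → x ≢ a → cyc w x ≡ t (cyc u (t x))
    cyc-switch-≢a x x≢a = by-cases (x Fin.≟ b)
      where
      by-cases : Dec (x ≡ b) → cyc w x ≡ t (cyc u (t x))
      by-cases (yes x≡b) = subst (λ y → cyc w y ≡ t (cyc u (t y))) (sym x≡b) cyc-switch-b
      by-cases (no x≢b)  = cyc-switch-other x x≢a x≢b

    -- At a itself: both sides are bijections that agree everywhere else.
    cyc-switch : ∀ x → cyc w x ≡ t (cyc u (t x))
    cyc-switch x = by-cases (x Fin.≟ a)
      where
      by-cases : Dec (x ≡ a) → cyc w x ≡ t (cyc u (t x))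
      by-cases (no x≢a)  = cyc-switch-≢a x x≢a
      by-cases (yes x≡a) = subst (λ y → cyc w y ≡ t (cyc u (t y))) (sym x≡a) (sym
        (≡-at-remaining (λ y → t (cyc u (t y))) (cyc w)
           (transpose-injective a b ∘ cyc-injective u ∘ transpose-injective a b) (cyc-surjective w) a
           (λ y y≢a → sym (cyc-switch-≢a y y≢a))))

    onlyUnshared⇒isSwitch : IsSwitch u w a b
    onlyUnshared⇒isSwitch = Sb≢a , Sa≢b , cyc-switch
      where
      one-at-b : lookup (vertex u J) b ≡ true
      one-at-b = trans (cong₂ lookup uJ≡wl (sym wl≡b)) (vertex-one-at-label w l)
      zero-after-b : lookup (vertex u J) (sucMod b) ≡ false
      zero-after-b = trans (cong₂ (λ ε c → lookup ε (sucMod c)) uJ≡wl (sym wl≡b)) (vertex-zero-after-label w l)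
      Sb≢a : ¬ (sucMod b ≡ a)
      Sb≢a eq = false≢true (trans (sym zero-after-b) (trans (cong (lookup (vertex u J)) eq) (vertex-one-at-label u J)))
      Sa≢b : ¬ (sucMod a ≡ b)
      Sa≢b eq = false≢true (trans (sym (vertex-zero-after-label u J)) (trans (cong (lookup (vertex u J)) eq) one-at-b))

  module _ .{{_ : NonZero m}} (u w : Permutation′ n) (J : Fin n)
           (switch : IsSwitch u w (u ⟨$⟩ʳ J) (u ⟨$⟩ʳ sucMod J)) where

    private
      a = u ⟨$⟩ʳ J
      b = u ⟨$⟩ʳ sucMod J
      t = PC.transpose a b
      σ = PC.transpose J (sucMod J)
      pos = u ⟨$⟩ˡ_
      h = dist J (w ⟨$⟩ˡ b)

    w-rotated : ∀ x → w ⟨$⟩ʳ (x ⊕ h) ≡ t (u ⟨$⟩ʳ x)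
    w-rotated = conjugate⇒rotation u w t (transpose-involutive a b) (proj₂ (proj₂ switch)) h J (begin
      w ⟨$⟩ʳ (J ⊕ h)     ≡⟨ cong (w ⟨$⟩ʳ_) (⊕-dist J (w ⟨$⟩ˡ b)) ⟩
      w ⟨$⟩ʳ (w ⟨$⟩ˡ b)  ≡⟨ inverseʳ w ⟩
      b                  ≡⟨ transpose-matchˡ a b ⟨
      t a                ∎)

    vertex-rotated : ∀ j → vertex w (j ⊕ h) ≡ vertexBy (σ ∘ pos) j
    vertex-rotated = vertexBy-⊕ h λ p → ⟨$⟩ʳ-injective w (begin
      w ⟨$⟩ʳ (w ⟨$⟩ˡ p)       ≡⟨ inverseʳ w ⟩
      p                       ≡⟨ transpose-involutive a b p ⟨
      t (t p)                 ≡⟨ cong t (inverseʳ u) ⟨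
      t (u ⟨$⟩ʳ pos (t p))    ≡⟨ cong (t ∘ (u ⟨$⟩ʳ_)) (⟨$⟩ˡ-transpose u J (sucMod J) p) ⟩
      t (u ⟨$⟩ʳ σ (pos p))    ≡⟨ w-rotated (σ (pos p)) ⟨
      w ⟨$⟩ʳ (σ (pos p) ⊕ h)  ∎)

    switched-vertex : ∀ j → j ≢ sucMod J → vertexBy (σ ∘ pos) j ≡ vertex u j
    switched-vertex j j≢SJ = vertexBy-transpose j≢SJ pos
      (λ p pos≡J pos′≡SJ → proj₁ switch (trans (cong sucMod (≡u pos′≡SJ)) (trans (sucMod-predMod p) (sym (≡u pos≡J)))))
      (λ p pos≡SJ pos′≡J → proj₁ (proj₂ switch) (trans (cong sucMod (≡u pos′≡J)) (trans (sucMod-predMod p) (sym (≡u pos≡SJ)))))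
      where
      ≡u : ∀ {p k} → pos p ≡ k → u ⟨$⟩ʳ k ≡ p
      ≡u eq = trans (cong (u ⟨$⟩ʳ_) (sym eq)) (inverseʳ u)

    unswitched-vertex : ∀ j → vertex u (sucMod J) ≢ vertexBy (σ ∘ pos) j
    unswitched-vertex j eq with j Fin.≟ sucMod J
    ... | no j≢SJ  = j≢SJ (sym (vertex-injective u (trans eq (switched-vertex j j≢SJ))))
    ... | yes refl = false≢true (begin
      false                                     ≡⟨ vertexBy-zero-at-end pos (sucMod J) a (cong sucMod (inverseˡ u)) ⟨
      lookup (vertex u (sucMod J)) a            ≡⟨ cong (λ ε → lookup ε a) eq ⟩
      lookup (vertexBy (σ ∘ pos) (sucMod J)) a  ≡⟨ vertexBy-one-at-start (σ ∘ pos) (sucMod J) a σpos-a (predMod≢ a ∘ ≡a) ⟩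
      true                                      ∎)
      where
      σpos-a : σ (pos a) ≡ sucMod J
      σpos-a = trans (cong σ (inverseˡ u)) (transpose-matchˡ J (sucMod J))
      ≡a : ∀ {p} → σ (pos p) ≡ sucMod J → p ≡ a
      ≡a eq′ = ⟨$⟩ˡ-injective u (transpose-injective J (sucMod J) (trans eq′ (sym σpos-a)))

    isSwitch⇒onlyUnshared : OnlyUnshared u w (sucMod J)
    isSwitch⇒onlyUnshared = unshared , shared
      where
      unshared : ∀ z → vertex u (sucMod J) ≢ vertex w z
      unshared z eq with y , refl ← ⊕-surjective h z = unswitched-vertex y (trans eq (vertex-rotated y))
      shared : ∀ y → y ≢ sucMod J → ∃[ z ] vertex u y ≡ vertex w z
      shared y y≢SJ = y ⊕ h , trans (sym (switched-vertex y y≢SJ)) (sym (vertex-rotated y))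

  onlyUnshared⇔isSwitch : .{{NonZero m}} → ∀ (u w : Permutation′ n) →
                          (∃[ i ] OnlyUnshared u w i) ⇔ (∃[ J ] IsSwitch u w (u ⟨$⟩ʳ J) (u ⟨$⟩ʳ sucMod J))
  onlyUnshared⇔isSwitch u w = mk⇔
    (λ (i , only) → predMod i , onlyUnshared⇒isSwitch u w (predMod i) (subst (OnlyUnshared u w) (sym (sucMod-predMod i)) only))
    (λ (J , switch) → sucMod J , isSwitch⇒onlyUnshared u w J switch)

  addMod≡⊕ : ∀ (i r : Fin n) → addMod i r ≡ r ⊕ toℕ i
  addMod≡⊕ i r = Fin.toℕ-injective (begin
    toℕ (addMod i r)     ≡⟨ Fin.toℕ-fromℕ< _ ⟩
    (toℕ i + toℕ r) % n  ≡⟨ cong (_% n) (+-comm (toℕ i) (toℕ r)) ⟩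
    (toℕ r + toℕ i) % n  ≡⟨ toℕ-⊕ r (toℕ i) ⟨
    toℕ (r ⊕ toℕ i)      ∎)

  addMod-sucMod : ∀ (i r : Fin n) → addMod (sucMod i) r ≡ sucMod (addMod i r)
  addMod-sucMod i r = begin
    addMod (sucMod i) r  ≡⟨ addMod≡⊕ (sucMod i) r ⟩
    r ⊕ toℕ (sucMod i)   ≡⟨ ⊕-toℕ-sucMod r i ⟩
    r ⊕ suc (toℕ i)      ≡⟨ ⊕-suc r (toℕ i) ⟩
    sucMod (r ⊕ toℕ i)   ≡⟨ cong sucMod (addMod≡⊕ i r) ⟨
    sucMod (addMod i r)  ∎

  -- A representative of (u) is a rotation of u, so only the position i + r of
  -- the switched pair matters.
  switchRelated⇔isSwitch : ∀ (u w : Permutation′ n) →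
                           SwitchRelated u w ⇔ (∃[ J ] IsSwitch u w (u ⟨$⟩ʳ J) (u ⟨$⟩ʳ sucMod J))
  switchRelated⇔isSwitch u w = mk⇔
    (λ (r , i , switch) → addMod i r , subst (IsSwitch u w (u ⟨$⟩ʳ addMod i r) ∘ (u ⟨$⟩ʳ_)) (addMod-sucMod i r) switch)
    (λ (J , switch) → J , fzero , subst₂ (λ i i′ → IsSwitch u w (u ⟨$⟩ʳ i) (u ⟨$⟩ʳ i′)) (sym J≡) (sym (SJ≡ J)) switch)
    where
    J≡ : ∀ {J} → addMod fzero J ≡ J
    J≡ {J} = addMod≡⊕ fzero J
    SJ≡ : ∀ J → addMod (sucMod fzero) J ≡ sucMod J
    SJ≡ J = trans (addMod-sucMod fzero J) (cong sucMod J≡)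

theorem2p9 : (k n : ℕ) → 0 < k → k < n → (u w : Permutation′ n)
    → InC k n u → InC k n w
    → SharesFacet k u w ⇔ SwitchRelated u w
theorem2p9 (suc _) (suc zero)    _   (s≤s ())
theorem2p9 k       (suc (suc _)) 0<k _ u w u∈C w∈C =
  ⇔-trans (sharesFacet⇔onlyUnshared u w (ones-vertex u u∈C 0<k) (ones-vertex w w∈C 0<k))
          (⇔-trans (onlyUnshared⇔isSwitch u w) (⇔-sym (switchRelated⇔isSwitch u w)))
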